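{- Let $A$ be a finite nonempty set of men (occupied cells) on a board that is a finite set of cells in $\mathbb{Z}^2$, with no other men on the board, and fix one of the 4-move, 6-move or 8-move rules described in the context. Let $\mathbf a_{\min}\in A$ be a man of minimum centroid and $\mathbf a_{\max}\in A$ a man of maximum centroid. Then a single move (a step or a chain of jumps by one man) changes the army centroid $c(A)$ by an amount in the interval $[-\delta,\delta]$, where $$\delta=c(\mathbf a_{\max})-c(\mathbf a_{\min})+\ell,$$ with $\ell=1$ for 4-move and 6-move rules and $\ell=2$ for 8-move rules.
   Context: Cells are identified with Cartesian coordinates $(x,y)$. Move rules: a set $D$ of allowed directions is fixed: 4-move $D=\{(\pm1,0),(0,\pm1)\}$; 6-move $D=\{(\pm1,0),(0,\pm1),\pm(1,1)\}$; 8-move $D=\{(a,b):a,b\in\{ -1,0,1\},(a,b)\ne(0,0)\}$. A move moves a single man either by a step from $p$ to an empty cell $p+v$ ($v\in D$), or by a chain of one or more jumps, each jump going from $p$ over an occupied cell $p+v$ ($v\in D$) into an empty cell $p+2v$ (jumped men are not removed). The centroid of a man $\mathbf a=(a_x,a_y)$ is $c(\mathbf a)=a_x-a_y$, and the centroid of an army is $c(A)=\sum_{\mathbf a\in A}c(\mathbf a)$. -}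

module Defs where

open import Data.Integer using (ℤ; +_; -_; _+_; _-_; _*_; _≤_)
open import Data.Product using (_×_; _,_; Σ; ∃)
open import Data.Sum using (_⊎_)
open import Data.List using (List; []; _∷_; map; foldr)
open import Data.List.Membership.Propositional using (_∈_)
open import Data.List.Relation.Unary.All using (All)
open import Data.Bool using (if_then_else_)
open import Relation.Binary.PropositionalEquality using (_≡_; _≢_)
open import Relation.Nullary.Decidable using (⌊_⌋; Dec)
open import Relation.Nullary using (¬_)
open import Data.Product.Properties using (≡-dec)
import Data.Integer.Properties as ℤP

Cell : Set
Cell = ℤ × ℤ

_⊕_ : Cell → Cell → Cell
(a , b) ⊕ (c , d) = (a + c , b + d)

twice : Cell → Cell
twice (a , b) = (a + a , b + b)

_≟c_ : (p q : Cell) → Dec (p ≡ q)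
_≟c_ = ≡-dec ℤP._≟_ ℤP._≟_

data Rule : Set where
  four six eight : Rule

data Dir : Rule → Cell → Set where
  d4  : ∀ {R v} → v ∈ ((+ 1 , + 0) ∷ (- + 1 , + 0) ∷ (+ 0 , + 1) ∷ (+ 0 , - + 1) ∷ []) → Dir R v
  d6  : ∀ {v} → v ∈ ((+ 1 , + 1) ∷ (- + 1 , - + 1) ∷ []) → Dir six v
  d8  : ∀ {v} → v ∈ ((+ 1 , + 1) ∷ (- + 1 , - + 1) ∷ (+ 1 , - + 1) ∷ (- + 1 , + 1) ∷ []) → Dir eight v

ℓ : Rule → ℤ
ℓ four  = + 1
ℓ six   = + 1
ℓ eight = + 2

c : Cell → ℤ
c (x , y) = x - y

centroid : List Cell → ℤ
centroid A = foldr (λ a s → c a + s) (+ 0) A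

-- A man at p in army A moves to q (the moving man is lifted from p).
module _ (R : Rule) (board : List Cell) (A : List Cell) (p : Cell) where

  Occupied : Cell → Set
  Occupied x = x ∈ A × x ≢ p

  Empty : Cell → Set
  Empty x = x ∈ board × (x ∈ A → x ≡ p)

  Step : Cell → Set
  Step q = Σ Cell λ v → Dir R v × q ≡ p ⊕ v × q ∈ board × ¬ (q ∈ A)

  data JumpChain : Cell → Set where
    first : ∀ {v} → Dir R v → Occupied (p ⊕ v) → Empty (p ⊕ twice v) →
            JumpChain (p ⊕ twice v)
    next  : ∀ {r v} → JumpChain r → Dir R v → Occupied (r ⊕ v) →
            Empty (r ⊕ twice v) → JumpChain (r ⊕ twice v)

  Move : Cell → Set
  Move q = Step q ⊎ JumpChain q

moveArmy : Cell → Cell → List Cell → List Cell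
moveArmy p q = map (λ a → if ⌊ a ≟c p ⌋ then q else a)

-- Only the moving man changes position, so the army centroid changes by c q − c p.
-- The landing cell q is one direction vector v beyond a man of A: beyond p itself
-- after a step, beyond the last man jumped over after a chain of jumps.  Hence
-- c q − c p = (c a − c p) + c v with a, p ∈ A and |c v| ≤ ℓ.
module Submission where

open import Defs
open import Data.Integer using (ℤ; _+_; _-_; -_; _≤_)
open import Data.Integer.Properties
  using (_≤?_; +-assoc; +-mono-≤; neg-mono-≤; neg-distrib-+)
open import Data.Integer.Tactic.RingSolver using (solve-∀)
open import Data.Product using (_×_; _,_; ∃₂)
open import Data.Sum using (inj₁; inj₂)
open import Data.List using (List; []; _∷_)
open import Data.List.Membership.Propositional using (_∈_; _∉_)
open import Data.List.Relation.Unary.All as All using (All)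
open import Data.List.Relation.Unary.Any using (here; there)
open import Data.List.Relation.Unary.Unique.Propositional using (Unique)
open import Data.List.Relation.Unary.AllPairs using (_∷_)
open import Data.Empty using (⊥-elim)
open import Relation.Binary.PropositionalEquality
open import Relation.Nullary using (Dec; yes; no; _×-dec_)
open import Relation.Nullary.Decidable using (True; toWitness)

Bounded : ℤ → ℤ → Set
Bounded l z = - l ≤ z × z ≤ l

bounded? : ∀ l z → Dec (Bounded l z)
bounded? l z = (- l ≤? z) ×-dec (z ≤? l)

+-bounded : ∀ {k l u z} → Bounded k u → Bounded l z → Bounded (k + l) (u + z)
+-bounded {k} {l} (-k≤u , u≤k) (-l≤z , z≤l) =
  subst (_≤ _) (sym (neg-distrib-+ k l)) (+-mono-≤ -k≤u -l≤z) , +-mono-≤ u≤k z≤l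

minus-bounded : ∀ {m M x y} → m ≤ x → x ≤ M → m ≤ y → y ≤ M → Bounded (M - m) (x - y)
minus-bounded {m} {M} m≤x x≤M m≤y y≤M =
  subst (_≤ _) (neg-[i-j] M m) (+-mono-≤ m≤x (neg-mono-≤ y≤M)) ,
  +-mono-≤ x≤M (neg-mono-≤ m≤y)
  where
  neg-[i-j] : ∀ i j → j - i ≡ - (i - j)
  neg-[i-j] = solve-∀

c-⊕ : ∀ p v → c (p ⊕ v) ≡ c p + c v
c-⊕ (a , b) (x , y) = identity a b x y
  where
  identity : ∀ a b x y → (a + x) - (b + y) ≡ (a - b) + (x - y)
  identity = solve-∀

c-⊕-twice : ∀ r v → c (r ⊕ twice v) ≡ c (r ⊕ v) + c v
c-⊕-twice r v@(_ , _) = begin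
  c (r ⊕ twice v)     ≡⟨ c-⊕ r (twice v) ⟩
  c r + c (twice v)   ≡⟨ cong (c r +_) (c-⊕ v v) ⟩
  c r + (c v + c v)   ≡⟨ sym (+-assoc (c r) (c v) (c v)) ⟩
  c r + c v + c v     ≡⟨ cong (_+ c v) (sym (c-⊕ r v)) ⟩
  c (r ⊕ v) + c v     ∎
  where open ≡-Reasoning

bounded-on : ∀ l vs {all-bounded : True (All.all? (λ v → bounded? l (c v)) vs)} →
             ∀ {v} → v ∈ vs → Bounded l (c v)
bounded-on l vs {all-bounded} = All.lookup (toWitness all-bounded)

-- d4 is shared by all rules; splitting on R lets ℓ R compute, so the bound can be decided.
c-Dir-bounded : ∀ {R v} → Dir R v → Bounded (ℓ R) (c v)
c-Dir-bounded {four}  (d4 v∈) = bounded-on _ _ v∈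
c-Dir-bounded {six}   (d4 v∈) = bounded-on _ _ v∈
c-Dir-bounded {eight} (d4 v∈) = bounded-on _ _ v∈
c-Dir-bounded         (d6 v∈) = bounded-on _ _ v∈
c-Dir-bounded         (d8 v∈) = bounded-on _ _ v∈

jump-lands-beyond-army : ∀ {R board A p q} → JumpChain R board A p q →
                         ∃₂ λ a v → a ∈ A × Dir R v × c q ≡ c a + c v
jump-lands-beyond-army {p = p} (first {v} d (pv∈A , _) _) = p ⊕ v , v , pv∈A , d , c-⊕-twice p v
jump-lands-beyond-army (next {r} {v} _ d (rv∈A , _) _)     = r ⊕ v , v , rv∈A , d , c-⊕-twice r v

move-lands-beyond-army : ∀ {R board A p q} → p ∈ A → Move R board A p q →
                         ∃₂ λ a v → a ∈ A × Dir R v × c q ≡ c a + c v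
move-lands-beyond-army {p = p} p∈A (inj₁ (v , d , refl , _)) = p , v , p∈A , d , c-⊕ p v
move-lands-beyond-army _ (inj₂ jumps) = jump-lands-beyond-army jumps

centroid-moveArmy-∉ : ∀ p q A → p ∉ A → centroid (moveArmy p q A) ≡ centroid A
centroid-moveArmy-∉ p q [] _ = refl
centroid-moveArmy-∉ p q (a ∷ A) p∉ with a ≟c p
... | yes refl = ⊥-elim (p∉ (here refl))
... | no _     = cong (c a +_) (centroid-moveArmy-∉ p q A (λ p∈ → p∉ (there p∈)))

centroid-moveArmy : ∀ p q A → Unique A → p ∈ A →
                    centroid (moveArmy p q A) ≡ centroid A + (c q - c p)
centroid-moveArmy p q (a ∷ A) (a∉A ∷ _) (here refl) with a ≟c a
... | no a≢a = ⊥-elim (a≢a refl)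
... | yes _  = begin
  c q + centroid (moveArmy a q A) ≡⟨ cong (c q +_) (centroid-moveArmy-∉ a q A (λ a∈ → All.lookup a∉A a∈ refl)) ⟩
  c q + centroid A                ≡⟨ identity (c q) (centroid A) (c a) ⟩
  c a + centroid A + (c q - c a)  ∎
  where
  open ≡-Reasoning
  identity : ∀ x s y → x + s ≡ y + s + (x - y)
  identity = solve-∀
centroid-moveArmy p q (a ∷ A) (a∉A ∷ uA) (there p∈A) with a ≟c p
... | yes refl = ⊥-elim (All.lookup a∉A p∈A refl)
... | no _     = begin
  c a + centroid (moveArmy p q A)   ≡⟨ cong (c a +_) (centroid-moveArmy p q A uA p∈A) ⟩
  c a + (centroid A + (c q - c p))  ≡⟨ sym (+-assoc (c a) (centroid A) (c q - c p)) ⟩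
  c a + centroid A + (c q - c p)    ∎
  where open ≡-Reasoning

centroid-change : ∀ p q A → Unique A → p ∈ A →
                  centroid (moveArmy p q A) - centroid A ≡ c q - c p
centroid-change p q A uA p∈A = begin
  centroid (moveArmy p q A) - centroid A  ≡⟨ cong (_- centroid A) (centroid-moveArmy p q A uA p∈A) ⟩
  centroid A + (c q - c p) - centroid A   ≡⟨ identity (centroid A) (c q - c p) ⟩
  c q - c p                               ∎
  where
  open ≡-Reasoning
  identity : ∀ s d → s + d - s ≡ d
  identity = solve-∀

theorem2 : (R : Rule) (board A : List Cell) →
    Unique board → Unique A → All (_∈ board) A →
    (amin amax : Cell) → amin ∈ A → amax ∈ A →
    All (λ a → c amin ≤ c a) A → All (λ a → c a ≤ c amax) A →
    (p q : Cell) → p ∈ A → Move R board A p q →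
    let δ = c amax - c amin + ℓ R
        Δ = centroid (moveArmy p q A) - centroid A
    in (- δ ≤ Δ) × (Δ ≤ δ)
theorem2 R board A _ uA _ amin amax _ _ ≥amin ≤amax p q p∈A move
  with move-lands-beyond-army p∈A move
... | a , v , a∈A , d , cq≡ =
  subst (Bounded (c amax - c amin + ℓ R)) (sym Δ≡) (+-bounded spread (c-Dir-bounded d))
  where
  spread : Bounded (c amax - c amin) (c a - c p)
  spread = minus-bounded (All.lookup ≥amin a∈A) (All.lookup ≤amax a∈A)
                     (All.lookup ≥amin p∈A) (All.lookup ≤amax p∈A)
  Δ≡ : centroid (moveArmy p q A) - centroid A ≡ c a - c p + c v
  Δ≡ = begin
    centroid (moveArmy p q A) - centroid A  ≡⟨ centroid-change p q A uA p∈A ⟩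
    c q - c p                               ≡⟨ cong (_- c p) cq≡ ⟩
    c a + c v - c p                         ≡⟨ identity (c a) (c v) (c p) ⟩
    c a - c p + c v                         ∎
    where
    open ≡-Reasoning
    identity : ∀ x z y → x + z - y ≡ x - y + z
    identity = solve-∀
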